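{- Let $a,b,c\in\mathbb{Z}$ with $a$ odd and $b$ even, and suppose $b^{2}-4ac=4^{\ell}\Delta$ where $\ell$ is the largest positive integer with $4^{\ell}\mid b^2-4ac$ and $\Delta\equiv m\pmod 8$ with $m\in\{2,3,5,6,7\}$. Then the 2-adic valuation trees of $f(n)=n^{2}+bn+ac$ and of $g(n)=an^{2}+bn+c$ have the same number of levels. Also, for every $s\in\mathbb{Z}$, the 2-adic valuation trees of $g(n)$ and of $g(n-s)=a(n-s)^{2}+b(n-s)+c$ have the same number of levels.
   Context: $\nu_2(x)$ denotes the 2-adic valuation of an integer $x$ (with $\nu_2(0)=+\infty$), $\mathbb{N}=\{0,1,2,\ldots\}$. The 2-adic valuation tree of a polynomial $h$: a node at level $i\geq 0$ is a residue class $\{2^{i}q+r: q\in\mathbb{N}\}$ with $0\le r<2^i$; a node is terminating if $\nu_2(h(n))$ is constant on its class, and non-terminating nodes split into $\{2^{i+1}q+r\}$, $\{2^{i+1}q+2^i+r\}$ at level $i+1$. The tree is finite with $\ell$ levels if $\ell$ is the smallest positive integer such that for every $r\in\{0,\ldots,2^{\ell}-1\}$ the sequence $(\nu_2(h(2^{\ell}q+r)))_{q\ge 0}$ is constant. -}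

module Defs where

open import Data.Nat as ℕ using (ℕ; zero; suc; _<_; _≤_)
open import Data.Nat.DivMod using (_/_; _%_)
open import Data.Integer as ℤ using (ℤ; +_)
open import Data.Maybe using (Maybe; just; nothing)
open import Data.Product using (_×_)
open import Relation.Nullary using (¬_)
open import Relation.Binary.PropositionalEquality using (_≡_)

-- 2-adic valuation of a natural number, computed with fuel.
-- For n ≠ 0 the valuation is < n, so fuel n suffices.
ν₂-fuel : ℕ → ℕ → ℕ
ν₂-fuel zero    n = zero
ν₂-fuel (suc f) zero = zero
ν₂-fuel (suc f) (suc n) with (suc n) % 2
... | zero  = suc (ν₂-fuel f ((suc n) / 2))
... | suc _ = zero

-- ν₂ on ℤ, with ν₂(0) = +∞ represented by nothing.
ν₂ : ℤ → Maybe ℕ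
ν₂ x with ℤ.∣ x ∣
... | zero  = nothing
... | suc n = just (ν₂-fuel (suc n) (suc n))

ConstantAtLevel : (ℕ → ℤ) → ℕ → Set
ConstantAtLevel h ℓ =
  ∀ r → r < 2 ℕ.^ ℓ → ∀ q → ν₂ (h (2 ℕ.^ ℓ ℕ.* q ℕ.+ r)) ≡ ν₂ (h r)

-- The 2-adic valuation tree of h is finite with exactly ℓ levels:
-- ℓ is the smallest positive integer with ConstantAtLevel h ℓ.
HasLevels : (ℕ → ℤ) → ℕ → Set
HasLevels h ℓ =
  1 ≤ ℓ × ConstantAtLevel h ℓ × (∀ k → 1 ≤ k → k < ℓ → ¬ ConstantAtLevel h k)

-- The two trees have the same number of levels (finite with equal ℓ, or both infinite).
SameLevels : (ℕ → ℤ) → (ℕ → ℤ) → Set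
SameLevels h₁ h₂ = ∀ ℓ → (HasLevels h₁ ℓ → HasLevels h₂ ℓ) × (HasLevels h₂ ℓ → HasLevels h₁ ℓ)

-- Neither f nor g has an integer root: 4 f(x) = (2x + b)² - 4^ℓ Δ, and 4^ℓ Δ is not a square
-- because Δ is not a square modulo 8. For h without integer roots that preserves congruences,
-- ν₂(h(2^k q + r)) is constant in q ≥ 0 for every r exactly when ν₂ ∘ h is 2^k-periodic on all
-- of ℤ, since ν₂(h x) = ν₂(h n) for every n ≡ x modulo a power of 2 beyond ν₂(h x).
-- Periodicity on ℤ is invariant under x ↦ x - s, and a g(x) = f(a x) transfers it between
-- g and f: the odd factor a does not change ν₂, and a is invertible modulo every power of 2.
module Submission where

open import Defs
open import Data.Empty using (⊥-elim)
open import Data.Integer as ℤ using (ℤ; +_; -[1+_]; 0ℤ; 1ℤ; _+_; _-_; _*_; -_; _^_)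
import Data.Integer.Properties as ℤ
open import Data.Integer.Divisibility using (_∣_)
open import Data.Integer.Divisibility.Signed as Signed using (divides; ∣ᵤ⇒∣; ∣⇒∣ᵤ; ∣-trans;
  ∣m∣n⇒∣m+n; ∣m∣n⇒∣m-n; ∣m⇒∣-m; ∣n⇒∣m*n; ∣m⇒∣m*n; *-monoʳ-∣; *-monoˡ-∣)
open import Data.Integer.DivMod using (_%ℕ_; _/ℕ_; n%ℕd<d; a≡a%ℕn+[a/ℕn]*n)
open import Data.Integer.Tactic.RingSolver using (solve-∀)
open import Data.Maybe using (just)
open import Data.Nat as ℕ using (ℕ; zero; suc; _≤_; _<_; z≤n; s≤s; NonZero)
import Data.Nat.Properties as ℕ
open import Data.Nat.DivMod using (_%_; _/_; m/n<m; m*[n/m]≡n; m%n<n; m≡m%n+[m/n]*n)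
import Data.Nat.Divisibility as ℕ
open import Data.Nat.Primality using (prime; 2-rough; euclidsLemma)
open import Data.Product using (∃; _×_; _,_; proj₁; proj₂)
open import Data.Sum using (_⊎_; inj₁; inj₂; reduce)
open import Function using (_∘_; _⇔_; mk⇔; Equivalence)
open import Function.Construct.Composition using (_⇔-∘_)
open import Function.Construct.Symmetry using (⇔-sym)
open import Relation.Binary.Definitions using (tri<; tri≈; tri>)
open import Relation.Binary.PropositionalEquality
open import Relation.Nullary using (¬_; yes; no)

infix 4 2^_∣_ 2^_∥_ 2^_∥ₙ_

2^_∣_ : ℕ → ℤ → Set
2^ j ∣ w = + (2 ℕ.^ j) Signed.∣ w

2^∣-weaken : ∀ {i j w} → i ≤ j → 2^ j ∣ w → 2^ i ∣ w
2^∣-weaken {i} {j} i≤j = ∣-trans (∣ᵤ⇒∣ (ℕ.divides (2 ℕ.^ (j ℕ.∸ i)) 2^j≡))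
  where
  2^j≡ : 2 ℕ.^ j ≡ 2 ℕ.^ (j ℕ.∸ i) ℕ.* 2 ℕ.^ i
  2^j≡ = begin
    2 ℕ.^ j                          ≡⟨ cong (2 ℕ.^_) (sym (ℕ.m+[n∸m]≡n i≤j)) ⟩
    2 ℕ.^ (i ℕ.+ (j ℕ.∸ i))          ≡⟨ ℕ.^-distribˡ-+-* 2 i (j ℕ.∸ i) ⟩
    2 ℕ.^ i ℕ.* 2 ℕ.^ (j ℕ.∸ i)      ≡⟨ ℕ.*-comm (2 ℕ.^ i) _ ⟩
    2 ℕ.^ (j ℕ.∸ i) ℕ.* 2 ℕ.^ i      ∎
    where open ≡-Reasoning

2^∣-square : ∀ {j x} → 2^ j ∣ x → 2^ (j ℕ.+ j) ∣ x * x
2^∣-square {j} {x} d =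
  subst (λ k → k Signed.∣ x * x) 2^j*2^j≡ (∣-trans (*-monoʳ-∣ (+ (2 ℕ.^ j)) d) (*-monoˡ-∣ x d))
  where
  2^j*2^j≡ : + (2 ℕ.^ j) * + (2 ℕ.^ j) ≡ + (2 ℕ.^ (j ℕ.+ j))
  2^j*2^j≡ = trans (sym (ℤ.pos-* (2 ℕ.^ j) _)) (cong +_ (sym (ℕ.^-distribˡ-+-* 2 j j)))

-- A record rather than a Σ-type, so that v can be inferred from a proof of 2^ v ∥ w.
record 2^_∥_ (v : ℕ) (w : ℤ) : Set where
  constructor mk∥
  field
    ∣w : 2^ v ∣ w
    ∤w : ¬ 2^ suc v ∣ w

∥-unique : ∀ {v v′ w} → 2^ v ∥ w → 2^ v′ ∥ w → v ≡ v′
∥-unique {v} {v′} (mk∥ d nd) (mk∥ d′ nd′) with ℕ.<-cmp v v′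
... | tri< v<v′ _ _ = ⊥-elim (nd (2^∣-weaken v<v′ d′))
... | tri≈ _ v≡v′ _ = v≡v′
... | tri> _ _ v′<v = ⊥-elim (nd′ (2^∣-weaken v′<v d))

∥-stable : ∀ {v x y} → 2^ v ∥ x → 2^ suc v ∣ x - y → 2^ v ∥ y
∥-stable {v} {x} {y} (mk∥ d nd) x≡y = mk∥
    (subst (2^ v ∣_) (x-[x-y]≡y x y) (∣m∣n⇒∣m-n d (2^∣-weaken (ℕ.n≤1+n v) x≡y)))
    (λ d′ → nd (subst (2^ suc v ∣_) ([x-y]+y≡x x y) (∣m∣n⇒∣m+n x≡y d′)))
  where
  x-[x-y]≡y : ∀ x y → x - (x - y) ≡ y
  x-[x-y]≡y = solve-∀
  [x-y]+y≡x : ∀ x y → (x - y) + y ≡ x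
  [x-y]+y≡x = solve-∀

2^_∥ₙ_ : ℕ → ℕ → Set
2^ v ∥ₙ n = 2 ℕ.^ v ℕ.∣ n × ¬ 2 ℕ.^ suc v ℕ.∣ n

∥ₙ-double : ∀ {v n} → 2^ v ∥ₙ n → 2^ suc v ∥ₙ 2 ℕ.* n
∥ₙ-double (d , nd) = ℕ.*-monoʳ-∣ 2 d , nd ∘ ℕ.*-cancelˡ-∣ 2

ν₂-fuel-∥ₙ : ∀ {f m} → 1 ≤ m → m ≤ f → 2^ ν₂-fuel f m ∥ₙ m
ν₂-fuel-∥ₙ {suc f} {suc n} _ (s≤s m≤f) with suc n % 2 in m%2≡
... | zero  = subst (2^ suc (ν₂-fuel f h) ∥ₙ_) 2h≡m (∥ₙ-double {ν₂-fuel f h} (ν₂-fuel-∥ₙ 1≤h h≤f))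
  where
  h : ℕ
  h = suc n / 2
  2h≡m : 2 ℕ.* h ≡ suc n
  2h≡m = m*[n/m]≡n (ℕ.m%n≡0⇒n∣m (suc n) 2 m%2≡)
  1≤h : 1 ≤ h
  1≤h = ℕ.n≢0⇒n>0 λ h≡0 → ℕ.0≢1+n (trans (cong (2 ℕ.*_) (sym h≡0)) 2h≡m)
  h≤f : h ≤ f
  h≤f = ℕ.≤-pred (ℕ.≤-trans (m/n<m (suc n) 2 (s≤s (s≤s z≤n))) (s≤s m≤f))
... | suc _ = ℕ.1∣ _ , λ 2∣m → ℕ.0≢1+n (trans (sym (ℕ.n∣m⇒m%n≡0 (suc n) 2 2∣m)) m%2≡)

∥ₙ⇒∥ : ∀ {v} w → 2^ v ∥ₙ ℤ.∣ w ∣ → 2^ v ∥ w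
∥ₙ⇒∥ _ (d , nd) = mk∥ (∣ᵤ⇒∣ d) (nd ∘ ∣⇒∣ᵤ)

ν₂-fuel-∥ : ∀ w {n} → ℤ.∣ w ∣ ≡ suc n → 2^ ν₂-fuel (suc n) (suc n) ∥ w
ν₂-fuel-∥ w {n} ∣w∣≡1+n = ∥ₙ⇒∥ {ν₂-fuel (suc n) (suc n)} w
  (subst (2^ ν₂-fuel (suc n) (suc n) ∥ₙ_) (sym ∣w∣≡1+n) (ν₂-fuel-∥ₙ (s≤s z≤n) ℕ.≤-refl))

∥⇒ν₂≡just : ∀ {v} w → 2^ v ∥ w → ν₂ w ≡ just v
∥⇒ν₂≡just (+ zero)      (mk∥ _ 2^suc∤0) = ⊥-elim (2^suc∤0 (divides 0ℤ refl))
∥⇒ν₂≡just w@(+ suc n)  ∥w = cong just (∥-unique (ν₂-fuel-∥ w refl) ∥w)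
∥⇒ν₂≡just w@(-[1+ n ]) ∥w = cong just (∥-unique (ν₂-fuel-∥ w refl) ∥w)

≢0⇒∃∥ : ∀ {w} → w ≢ 0ℤ → ∃ λ v → 2^ v ∥ w
≢0⇒∃∥ {+ zero}       w≢0 = ⊥-elim (w≢0 refl)
≢0⇒∃∥ {w@(+ suc n)}  _   = ν₂-fuel (suc n) (suc n) , ν₂-fuel-∥ w refl
≢0⇒∃∥ {w@(-[1+ n ])} _   = ν₂-fuel (suc n) (suc n) , ν₂-fuel-∥ w refl

∥⇒ν₂≡ : ∀ {v x y} → 2^ v ∥ x → 2^ v ∥ y → ν₂ x ≡ ν₂ y
∥⇒ν₂≡ {x = x} {y} ∥x ∥y = trans (∥⇒ν₂≡just x ∥x) (sym (∥⇒ν₂≡just y ∥y))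

newton-step : ∀ {j a u} → 2^ j ∣ a * u - 1ℤ → 2^ (j ℕ.+ j) ∣ a * (u * (+ 2 - a * u)) - 1ℤ
newton-step {j} {a} {u} d = subst (2^ (j ℕ.+ j) ∣_) (-[au-1]²≡ a u) (∣m⇒∣-m (2^∣-square {j} d))
  where
  -[au-1]²≡ : ∀ a u → - ((a * u - 1ℤ) * (a * u - 1ℤ)) ≡ a * (u * (+ 2 - a * u)) - 1ℤ
  -[au-1]²≡ = solve-∀

odd⇒invertible : ∀ {a} → 2^ 1 ∣ a - 1ℤ → ∀ N → ∃ λ u → 2^ suc N ∣ a * u - 1ℤ
odd⇒invertible {a} odd zero = 1ℤ , subst (λ x → 2^ 1 ∣ x - 1ℤ) (sym (ℤ.*-identityʳ a)) odd
odd⇒invertible {a} odd (suc N) with odd⇒invertible {a} odd N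
... | u , au≡1 = u * (+ 2 - a * u) , 2^∣-weaken (s≤s (ℕ.m≤n+m (suc N) N)) (newton-step {suc N} {a} au≡1)

∥-*-odd : ∀ {a v z} → 2^ 1 ∣ a - 1ℤ → 2^ v ∥ z → 2^ v ∥ a * z
∥-*-odd {a} {v} {z} odd (mk∥ d nd) = mk∥ (∣n⇒∣m*n a d) λ d′ →
  nd (subst (2^ suc v ∣_) (u[az]-[au-1]z≡z a z u) (∣m∣n⇒∣m-n (∣n⇒∣m*n u d′) (∣m⇒∣m*n z au≡1)))
  where
  u : ℤ
  u = proj₁ (odd⇒invertible {a} odd v)
  au≡1 : 2^ suc v ∣ a * u - 1ℤ
  au≡1 = proj₂ (odd⇒invertible {a} odd v)
  u[az]-[au-1]z≡z : ∀ a z u → u * (a * z) - (a * u - 1ℤ) * z ≡ z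
  u[az]-[au-1]z≡z = solve-∀

ν₂-*-odd : ∀ {a} → 2^ 1 ∣ a - 1ℤ → ∀ z → ν₂ (a * z) ≡ ν₂ z
ν₂-*-odd {a} odd z with z ℤ.≟ 0ℤ
... | yes refl = cong ν₂ (ℤ.*-zeroʳ a)
... | no z≢0   = ∥⇒ν₂≡ (∥-*-odd {a} odd ∥z) ∥z
  where
  ∥z : 2^ proj₁ (≢0⇒∃∥ z≢0) ∥ z
  ∥z = proj₂ (≢0⇒∃∥ z≢0)

PreservesCongruences : (ℤ → ℤ) → Set
PreservesCongruences h = ∀ {d} x y → d Signed.∣ x - y → d Signed.∣ h x - h y

difference-factors⇒preservesCongruences : ∀ {h} (q : ℤ → ℤ → ℤ) →
  (∀ x y → h x - h y ≡ (x - y) * q x y) → PreservesCongruences h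
difference-factors⇒preservesCongruences {h} q factors {d} x y d∣x-y =
  subst (d Signed.∣_) (sym (factors x y)) (∣m⇒∣m*n (q x y) d∣x-y)

*-preservesCongruences : ∀ a → PreservesCongruences (a *_)
*-preservesCongruences a = difference-factors⇒preservesCongruences {a *_} (λ _ _ → a) (ax-ay≡[x-y]a a)
  where
  ax-ay≡[x-y]a : ∀ a x y → a * x - a * y ≡ (x - y) * a
  ax-ay≡[x-y]a = solve-∀

square-preservesCongruences : PreservesCongruences (λ x → x * x)
square-preservesCongruences = difference-factors⇒preservesCongruences {λ x → x * x} _+_ x²-y²≡
  where
  x²-y²≡ : ∀ x y → x * x - y * y ≡ (x - y) * (x + y)
  x²-y²≡ = solve-∀

∣x-x%ℕd : ∀ x d .{{_ : NonZero d}} → + d Signed.∣ x - + (x %ℕ d)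
∣x-x%ℕd x d = divides (x /ℕ d)
  (trans (cong (_- + (x %ℕ d)) (a≡a%ℕn+[a/ℕn]*n x d)) ([r+qd]-r≡qd (+ (x %ℕ d)) (x /ℕ d) (+ d)))
  where
  [r+qd]-r≡qd : ∀ r q d → (r + q * d) - r ≡ q * d
  [r+qd]-r≡qd = solve-∀

residues-≡ : ∀ {d m n} → m < d → n < d → + d Signed.∣ + m - + n → m ≡ n
residues-≡ {d} {m} {n} m<d n<d d∣m-n with ℤ.∣ + m - + n ∣ in ∣m-n∣≡
... | zero  = ℤ.+-injective (ℤ.i-j≡0⇒i≡j (+ m) (+ n) (ℤ.∣i∣≡0⇒i≡0 ∣m-n∣≡))
... | suc k = ⊥-elim (ℕ.<⇒≱ ∣m-n∣<d (ℕ.∣⇒≤ (subst (d ℕ.∣_) ∣m-n∣≡ (∣⇒∣ᵤ d∣m-n))))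
  where
  ∣m-n∣<d : suc k < d
  ∣m-n∣<d = begin-strict
    suc k              ≡⟨ sym ∣m-n∣≡ ⟩
    ℤ.∣ + m - + n ∣    ≡⟨ cong ℤ.∣_∣ (ℤ.[+m]-[+n]≡m⊖n m n) ⟩
    ℤ.∣ m ℤ.⊖ n ∣      ≤⟨ ℤ.∣m⊝n∣≤m⊔n m n ⟩
    m ℕ.⊔ n            <⟨ ℕ.⊔-lub m<d n<d ⟩
    d                  ∎
    where open ℕ.≤-Reasoning

%ℕ-cong : ∀ {d} .{{_ : NonZero d}} x y → + d Signed.∣ x - y → x %ℕ d ≡ y %ℕ d
%ℕ-cong {d} x y d∣x-y = residues-≡ (n%ℕd<d x d) (n%ℕd<d y d)
  (subst (+ d Signed.∣_) (rearrange x y _ _) (∣m∣n⇒∣m+n (∣m∣n⇒∣m-n d∣x-y (∣x-x%ℕd x d)) (∣x-x%ℕd y d)))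
  where
  rearrange : ∀ x y r s → ((x - y) - (x - r)) + (y - s) ≡ r - s
  rearrange = solve-∀

¬2∣⇒odd : ∀ a → ¬ (+ 2 ∣ a) → 2^ 1 ∣ a - 1ℤ
¬2∣⇒odd a ¬2∣a with a %ℕ 2 | n%ℕd<d a 2 | ∣x-x%ℕd a 2
... | 0           | _            | 2∣a-0 = ⊥-elim (¬2∣a (∣⇒∣ᵤ (subst (+ 2 Signed.∣_) (ℤ.+-identityʳ a) 2∣a-0)))
... | 1           | _            | 2∣a-1 = 2∣a-1
... | suc (suc _) | s≤s (s≤s ()) | _

NonVanishing : (ℤ → ℤ) → Set
NonVanishing h = ∀ x → h x ≢ 0ℤ

ν₂-Periodic : (ℤ → ℤ) → ℕ → Set
ν₂-Periodic h k = ∀ x y → 2^ k ∣ x - y → ν₂ (h x) ≡ ν₂ (h y)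

periodic⇒constantAtLevel : ∀ {h k} → ν₂-Periodic h k → ConstantAtLevel (h ∘ +_) k
periodic⇒constantAtLevel {h} {k} periodic r _ q = periodic _ _ (divides (+ q) [2^k*q+r]-r≡q*2^k)
  where
  [2^k*q+r]-r≡q*2^k : + (2 ℕ.^ k ℕ.* q ℕ.+ r) - + r ≡ + q * + (2 ℕ.^ k)
  [2^k*q+r]-r≡q*2^k = begin
    + (2 ℕ.^ k ℕ.* q ℕ.+ r) - + r      ≡⟨ cong (_- + r) (ℤ.pos-+ (2 ℕ.^ k ℕ.* q) r) ⟩
    (+ (2 ℕ.^ k ℕ.* q) + + r) - + r    ≡⟨ cong (λ z → (z + + r) - + r) (ℤ.pos-* (2 ℕ.^ k) q) ⟩
    (+ (2 ℕ.^ k) * + q + + r) - + r    ≡⟨ [pq+r]-r≡qp (+ (2 ℕ.^ k)) (+ q) (+ r) ⟩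
    + q * + (2 ℕ.^ k)                  ∎
    where
    open ≡-Reasoning
    [pq+r]-r≡qp : ∀ p q r → (p * q + r) - r ≡ q * p
    [pq+r]-r≡qp = solve-∀

module _ {k : ℕ} where

  private instance
    2^k-nonZero : NonZero (2 ℕ.^ k)
    2^k-nonZero = ℕ.m^n≢0 2 k

  constantAtLevel-% : ∀ {g} → ConstantAtLevel g k → ∀ n → ν₂ (g n) ≡ ν₂ (g (n % 2 ℕ.^ k))
  constantAtLevel-% {g} constant n = trans (cong (ν₂ ∘ g) n≡) (constant r (m%n<n n (2 ℕ.^ k)) q)
    where
    q r : ℕ
    q = n / 2 ℕ.^ k
    r = n % 2 ℕ.^ k
    n≡ : n ≡ 2 ℕ.^ k ℕ.* q ℕ.+ r
    n≡ = trans (m≡m%n+[m/n]*n n (2 ℕ.^ k)) (trans (ℕ.+-comm r _) (cong (ℕ._+ r) (ℕ.*-comm q (2 ℕ.^ k))))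

  module _ {h : ℤ → ℤ} (h≢0 : NonVanishing h) (h-cong : PreservesCongruences h) where

    -- Reduce x modulo 2^M with M > ν₂ (h x), which fixes ν₂ (h x), and M ≥ k, which keeps x mod 2^k.
    ν₂-at-residue : ConstantAtLevel (h ∘ +_) k → ∀ x → ν₂ (h x) ≡ ν₂ (h (+ (x %ℕ 2 ℕ.^ k)))
    ν₂-at-residue constant x = begin
      ν₂ (h x)                   ≡⟨ ∥⇒ν₂≡ ∥hx ∥hn ⟩
      ν₂ (h (+ n))               ≡⟨ constantAtLevel-% {h ∘ +_} constant n ⟩
      ν₂ (h (+ (n % 2 ℕ.^ k)))   ≡⟨ cong (ν₂ ∘ h ∘ +_) (%ℕ-cong x (+ n) (2^∣-weaken (ℕ.m≤n+m k (suc v)) x≡n)) ⟨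
      ν₂ (h (+ (x %ℕ 2 ℕ.^ k)))  ∎
      where
      open ≡-Reasoning
      v : ℕ
      v = proj₁ (≢0⇒∃∥ (h≢0 x))
      ∥hx : 2^ v ∥ h x
      ∥hx = proj₂ (≢0⇒∃∥ (h≢0 x))
      M : ℕ
      M = suc v ℕ.+ k
      instance
        2^M-nonZero : NonZero (2 ℕ.^ M)
        2^M-nonZero = ℕ.m^n≢0 2 M
      n : ℕ
      n = x %ℕ 2 ℕ.^ M
      x≡n : 2^ M ∣ x - + n
      x≡n = ∣x-x%ℕd x (2 ℕ.^ M)
      ∥hn : 2^ v ∥ h (+ n)
      ∥hn = ∥-stable ∥hx (2^∣-weaken (ℕ.m≤m+n (suc v) k) (h-cong x (+ n) x≡n))

    constantAtLevel⇒periodic : ConstantAtLevel (h ∘ +_) k → ν₂-Periodic h k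
    constantAtLevel⇒periodic constant x y x≡y = begin
      ν₂ (h x)                   ≡⟨ ν₂-at-residue constant x ⟩
      ν₂ (h (+ (x %ℕ 2 ℕ.^ k)))  ≡⟨ cong (ν₂ ∘ h ∘ +_) (%ℕ-cong x y x≡y) ⟩
      ν₂ (h (+ (y %ℕ 2 ℕ.^ k)))  ≡⟨ ν₂-at-residue constant y ⟨
      ν₂ (h y)                   ∎
      where open ≡-Reasoning

    constantAtLevel⇔periodic : ConstantAtLevel (h ∘ +_) k ⇔ ν₂-Periodic h k
    constantAtLevel⇔periodic = mk⇔ constantAtLevel⇒periodic (periodic⇒constantAtLevel {h} {k})

hasLevels-transport : ∀ {h₁ h₂ : ℕ → ℤ} → (∀ k → ConstantAtLevel h₁ k ⇔ ConstantAtLevel h₂ k) →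
                      ∀ {ℓ} → HasLevels h₁ ℓ → HasLevels h₂ ℓ
hasLevels-transport {h₁} {h₂} same {ℓ} (1≤ℓ , constant , minimal) =
  1≤ℓ , Equivalence.to (same ℓ) constant , λ k 1≤k k<ℓ → minimal k 1≤k k<ℓ ∘ Equivalence.from (same k)

sameLevels-by-levels : ∀ {h₁ h₂ : ℕ → ℤ} → (∀ k → ConstantAtLevel h₁ k ⇔ ConstantAtLevel h₂ k) →
                       SameLevels h₁ h₂
sameLevels-by-levels {h₁} {h₂} same _ =
  hasLevels-transport {h₁} {h₂} same , hasLevels-transport {h₂} {h₁} (⇔-sym ∘ same)

sameLevels-by-periodicity : ∀ {h₁ h₂} →
  NonVanishing h₁ → PreservesCongruences h₁ → NonVanishing h₂ → PreservesCongruences h₂ →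
  (∀ k → ν₂-Periodic h₁ k ⇔ ν₂-Periodic h₂ k) → SameLevels (h₁ ∘ +_) (h₂ ∘ +_)
sameLevels-by-periodicity {h₁} {h₂} h₁≢0 h₁-cong h₂≢0 h₂-cong periodic⇔ =
  sameLevels-by-levels {h₁ ∘ +_} {h₂ ∘ +_} λ k →
    ⇔-sym (constantAtLevel⇔periodic {k} h₂≢0 h₂-cong)
      ⇔-∘ (periodic⇔ k ⇔-∘ constantAtLevel⇔periodic {k} h₁≢0 h₁-cong)

module _ (h : ℤ → ℤ) (s : ℤ) where

  private
    [x-s]-[y-s]≡x-y : ∀ x y s → (x - s) - (y - s) ≡ x - y
    [x-s]-[y-s]≡x-y = solve-∀
    [x+s]-[y+s]≡x-y : ∀ x y s → (x + s) - (y + s) ≡ x - y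
    [x+s]-[y+s]≡x-y = solve-∀
    [x+s]-s≡x : ∀ x s → (x + s) - s ≡ x
    [x+s]-s≡x = solve-∀

  shift-preservesCongruences : PreservesCongruences h → PreservesCongruences (λ x → h (x - s))
  shift-preservesCongruences h-cong {d} x y d∣x-y =
    h-cong (x - s) (y - s) (subst (d Signed.∣_) (sym ([x-s]-[y-s]≡x-y x y s)) d∣x-y)

  ν₂-Periodic-shift : ∀ k → ν₂-Periodic h k ⇔ ν₂-Periodic (λ x → h (x - s)) k
  ν₂-Periodic-shift k = mk⇔
    (λ periodic x y x≡y → periodic (x - s) (y - s) (subst (2^ k ∣_) (sym ([x-s]-[y-s]≡x-y x y s)) x≡y))
    (λ periodic x y x≡y → begin
      ν₂ (h x)                ≡⟨ cong (ν₂ ∘ h) ([x+s]-s≡x x s) ⟨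
      ν₂ (h ((x + s) - s))    ≡⟨ periodic (x + s) (y + s) (subst (2^ k ∣_) (sym ([x+s]-[y+s]≡x-y x y s)) x≡y) ⟩
      ν₂ (h ((y + s) - s))    ≡⟨ cong (ν₂ ∘ h) ([x+s]-s≡x y s) ⟩
      ν₂ (h y)                ∎)
    where open ≡-Reasoning

module _ {a : ℤ} (odd : 2^ 1 ∣ a - 1ℤ) {h₁ h₂ : ℤ → ℤ} (a*h₂≡h₁∘a* : ∀ x → a * h₂ x ≡ h₁ (a * x)) where

  ν₂-h₂≡ν₂-h₁∘a* : ∀ x → ν₂ (h₂ x) ≡ ν₂ (h₁ (a * x))
  ν₂-h₂≡ν₂-h₁∘a* x = trans (sym (ν₂-*-odd {a} odd (h₂ x))) (cong ν₂ (a*h₂≡h₁∘a* x))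

  rescale-nonVanishing : NonVanishing h₁ → NonVanishing h₂
  rescale-nonVanishing h₁≢0 x h₂x≡0 =
    h₁≢0 (a * x) (trans (sym (a*h₂≡h₁∘a* x)) (trans (cong (a *_) h₂x≡0) (ℤ.*-zeroʳ a)))

  ν₂-h₁≡ν₂-h₂∘u* : ∀ {v N u} → PreservesCongruences h₁ → ∀ z → 2^ v ∥ h₁ z → v < N → 2^ N ∣ a * u - 1ℤ →
                   ν₂ (h₁ z) ≡ ν₂ (h₂ (u * z))
  ν₂-h₁≡ν₂-h₂∘u* {v} {N} {u} h₁-cong z ∥h₁z v<N au≡1 = begin
    ν₂ (h₁ z)             ≡⟨ ∥⇒ν₂≡ ∥h₁z (∥-stable ∥h₁z (2^∣-weaken v<N (h₁-cong z (a * (u * z)) z≡auz))) ⟩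
    ν₂ (h₁ (a * (u * z))) ≡⟨ ν₂-h₂≡ν₂-h₁∘a* (u * z) ⟨
    ν₂ (h₂ (u * z))       ∎
    where
    open ≡-Reasoning
    z-auz≡ : ∀ a u z → z - a * (u * z) ≡ - ((a * u - 1ℤ) * z)
    z-auz≡ = solve-∀
    z≡auz : 2^ N ∣ z - a * (u * z)
    z≡auz = subst (2^ N ∣_) (sym (z-auz≡ a u z)) (∣m⇒∣-m (∣m⇒∣m*n z au≡1))

  ν₂-Periodic-rescale : NonVanishing h₁ → PreservesCongruences h₁ →
                        ∀ k → ν₂-Periodic h₁ k ⇔ ν₂-Periodic h₂ k
  ν₂-Periodic-rescale h₁≢0 h₁-cong k = mk⇔
    (λ periodic x y x≡y → begin
      ν₂ (h₂ x)        ≡⟨ ν₂-h₂≡ν₂-h₁∘a* x ⟩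
      ν₂ (h₁ (a * x))  ≡⟨ periodic (a * x) (a * y) (*-preservesCongruences a x y x≡y) ⟩
      ν₂ (h₁ (a * y))  ≡⟨ ν₂-h₂≡ν₂-h₁∘a* y ⟨
      ν₂ (h₂ y)        ∎)
    λ periodic x y x≡y →
      let vx , ∥h₁x = ≢0⇒∃∥ (h₁≢0 x)
          vy , ∥h₁y = ≢0⇒∃∥ (h₁≢0 y)
          u , au≡1 = odd⇒invertible {a} odd (vx ℕ.+ vy)
      in begin
      ν₂ (h₁ x)        ≡⟨ ν₂-h₁≡ν₂-h₂∘u* {u = u} h₁-cong x ∥h₁x (s≤s (ℕ.m≤m+n vx vy)) au≡1 ⟩
      ν₂ (h₂ (u * x))  ≡⟨ periodic (u * x) (u * y) (*-preservesCongruences u x y x≡y) ⟩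
      ν₂ (h₂ (u * y))  ≡⟨ ν₂-h₁≡ν₂-h₂∘u* {u = u} h₁-cong y ∥h₁y (s≤s (ℕ.m≤n+m vy vx)) au≡1 ⟨
      ν₂ (h₁ y)        ∎
    where open ≡-Reasoning

data QuadraticResidue₈ : ℕ → Set where
  qr₀ : QuadraticResidue₈ 0
  qr₁ : QuadraticResidue₈ 1
  qr₄ : QuadraticResidue₈ 4

QuadraticNonResidue₈ : ℕ → Set
QuadraticNonResidue₈ m = m ≡ 2 ⊎ m ≡ 3 ⊎ m ≡ 5 ⊎ m ≡ 6 ⊎ m ≡ 7

nonResidue⇒¬residue : ∀ {m} → QuadraticNonResidue₈ m → ¬ QuadraticResidue₈ (m % 8)
nonResidue⇒¬residue (inj₁ refl) ()
nonResidue⇒¬residue (inj₂ (inj₁ refl)) ()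
nonResidue⇒¬residue (inj₂ (inj₂ (inj₁ refl))) ()
nonResidue⇒¬residue (inj₂ (inj₂ (inj₂ (inj₁ refl)))) ()
nonResidue⇒¬residue (inj₂ (inj₂ (inj₂ (inj₂ refl)))) ()

square%8-residue : ∀ r → r < 8 → QuadraticResidue₈ (r ℕ.* r % 8)
square%8-residue 0 _ = qr₀
square%8-residue 1 _ = qr₁
square%8-residue 2 _ = qr₄
square%8-residue 3 _ = qr₁
square%8-residue 4 _ = qr₀
square%8-residue 5 _ = qr₁
square%8-residue 6 _ = qr₄
square%8-residue 7 _ = qr₁
square%8-residue (suc (suc (suc (suc (suc (suc (suc (suc r)))))))) 8+r<8 =
  ⊥-elim (ℕ.≤⇒≯ (ℕ.m≤m+n 8 r) 8+r<8)

square%ℕ8-residue : ∀ t → QuadraticResidue₈ (t * t %ℕ 8)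
square%ℕ8-residue t = subst QuadraticResidue₈ (sym t²≡r²) (square%8-residue r (n%ℕd<d t 8))
  where
  r : ℕ
  r = t %ℕ 8
  t²≡r² : t * t %ℕ 8 ≡ r ℕ.* r % 8
  t²≡r² = trans (%ℕ-cong (t * t) (+ r * + r) (square-preservesCongruences t (+ r) (∣x-x%ℕd t 8)))
                (cong (_%ℕ 8) (sym (ℤ.pos-* r r)))

2∣square⇒2∣ : ∀ t → + 2 Signed.∣ t * t → + 2 Signed.∣ t
2∣square⇒2∣ t 2∣t² = ∣ᵤ⇒∣ (reduce (euclidsLemma ℤ.∣ t ∣ ℤ.∣ t ∣ (prime 2-rough)
                                     (subst (2 ℕ.∣_) (ℤ.abs-* t t) (∣⇒∣ᵤ 2∣t²))))

square≡4*⇒square : ∀ t X → t * t ≡ + 4 * X → ∃ λ s → s * s ≡ X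
square≡4*⇒square t X t²≡4X with 2∣square⇒2∣ t (divides (+ 2 * X) (trans t²≡4X (4X≡[2X]2 X)))
  where
  4X≡[2X]2 : ∀ X → + 4 * X ≡ (+ 2 * X) * + 2
  4X≡[2X]2 = solve-∀
... | divides s refl = s , ℤ.*-cancelˡ-≡ (+ 4) (s * s) X (trans (sym ([2s]²≡4s² s)) t²≡4X)
  where
  [2s]²≡4s² : ∀ s → (s * + 2) * (s * + 2) ≡ + 4 * (s * s)
  [2s]²≡4s² = solve-∀

module _ {Δ : ℤ} {m : ℕ} (nonResidue : QuadraticNonResidue₈ m) (Δ≡m : + 8 Signed.∣ Δ - + m) where

  4^ℓ*Δ-nonsquare : ∀ ℓ t → t * t ≢ (+ 4) ^ ℓ * Δ
  4^ℓ*Δ-nonsquare zero t t²≡Δ =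
    nonResidue⇒¬residue nonResidue (subst QuadraticResidue₈ t²%8≡m (square%ℕ8-residue t))
    where
    t²%8≡m : t * t %ℕ 8 ≡ m % 8
    t²%8≡m = %ℕ-cong (t * t) (+ m)
      (subst (λ z → + 8 Signed.∣ z - + m) (sym (trans t²≡Δ (ℤ.*-identityˡ Δ))) Δ≡m)
  4^ℓ*Δ-nonsquare (suc ℓ) t t²≡ =
    let s , s²≡ = square≡4*⇒square t ((+ 4) ^ ℓ * Δ) (trans t²≡ (ℤ.*-assoc (+ 4) ((+ 4) ^ ℓ) Δ))
    in 4^ℓ*Δ-nonsquare ℓ s s²≡

f g : ℤ → ℤ → ℤ → ℤ → ℤ
f a b c x = x * x + b * x + a * c
g a b c x = a * x * x + b * x + c

f-preservesCongruences : ∀ a b c → PreservesCongruences (f a b c)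
f-preservesCongruences a b c =
  difference-factors⇒preservesCongruences {f a b c} (λ x y → x + y + b) (f-difference a b c)
  where
  f-difference : ∀ a b c x y → (x * x + b * x + a * c) - (y * y + b * y + a * c) ≡ (x - y) * (x + y + b)
  f-difference = solve-∀

g-preservesCongruences : ∀ a b c → PreservesCongruences (g a b c)
g-preservesCongruences a b c =
  difference-factors⇒preservesCongruences {g a b c} (λ x y → a * (x + y) + b) (g-difference a b c)
  where
  g-difference : ∀ a b c x y →
    (a * x * x + b * x + c) - (a * y * y + b * y + c) ≡ (x - y) * (a * (x + y) + b)
  g-difference = solve-∀

a*g≡f∘a* : ∀ a b c x → a * g a b c x ≡ f a b c (a * x)
a*g≡f∘a* = a*g≡f∘a*′
  where
  a*g≡f∘a*′ : ∀ a b c x → a * (a * x * x + b * x + c) ≡ (a * x) * (a * x) + b * (a * x) + a * c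
  a*g≡f∘a*′ = solve-∀

f-nonVanishing : ∀ {a b c ℓ Δ m} → b * b - (+ 4) * a * c ≡ ((+ 4) ^ ℓ) * Δ →
                 QuadraticNonResidue₈ m → + 8 Signed.∣ Δ - + m → NonVanishing (f a b c)
f-nonVanishing {a} {b} {c} {ℓ} {Δ} disc nonResidue Δ≡m x fx≡0 =
  4^ℓ*Δ-nonsquare nonResidue Δ≡m ℓ (+ 2 * x + b) (begin
    (+ 2 * x + b) * (+ 2 * x + b)              ≡⟨ complete-square a b c x ⟩
    (b * b - (+ 4) * a * c) + + 4 * f a b c x  ≡⟨ cong (λ z → (b * b - (+ 4) * a * c) + + 4 * z) fx≡0 ⟩
    (b * b - (+ 4) * a * c) + + 4 * 0ℤ         ≡⟨ ℤ.+-identityʳ _ ⟩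
    b * b - (+ 4) * a * c                      ≡⟨ disc ⟩
    ((+ 4) ^ ℓ) * Δ                            ∎)
  where
  open ≡-Reasoning
  complete-square : ∀ a b c x →
    (+ 2 * x + b) * (+ 2 * x + b) ≡ (b * b - (+ 4) * a * c) + + 4 * (x * x + b * x + a * c)
  complete-square = solve-∀

lemma21 : (a b c : ℤ) (ℓ : ℕ) (Δ : ℤ) →
    ¬ ((+ 2) ∣ a) → (+ 2) ∣ b →
    b * b - (+ 4) * a * c ≡ ((+ 4) ^ ℓ) * Δ →
    1 ℕ.≤ ℓ →
    (∀ k → 1 ℕ.≤ k → ((+ 4) ^ k) ∣ (b * b - (+ 4) * a * c) → k ℕ.≤ ℓ) →
    (∃ λ m → (m ≡ 2 ⊎ m ≡ 3 ⊎ m ≡ 5 ⊎ m ≡ 6 ⊎ m ≡ 7) × (+ 8) ∣ (Δ - (+ m))) →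
    SameLevels (λ n → (+ n) * (+ n) + b * (+ n) + a * c)
               (λ n → a * (+ n) * (+ n) + b * (+ n) + c)
    × (∀ (s : ℤ) → SameLevels (λ n → a * (+ n) * (+ n) + b * (+ n) + c)
                              (λ n → a * ((+ n) - s) * ((+ n) - s) + b * ((+ n) - s) + c))
lemma21 a b c ℓ Δ ¬2∣a _ disc _ _ (m , nonResidue , 8∣Δ-m) =
    sameLevels-by-periodicity {f a b c} {g a b c} f≢0 f-cong g≢0 g-cong
      (ν₂-Periodic-rescale {a} odd (a*g≡f∘a* a b c) f≢0 f-cong)
  , λ s → sameLevels-by-periodicity {g a b c} {λ x → g a b c (x - s)} g≢0 g-cong (g≢0 ∘ (_- s))
            (shift-preservesCongruences (g a b c) s g-cong) (ν₂-Periodic-shift (g a b c) s)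
  where
  odd : 2^ 1 ∣ a - 1ℤ
  odd = ¬2∣⇒odd a ¬2∣a
  f-cong : PreservesCongruences (f a b c)
  f-cong = f-preservesCongruences a b c
  g-cong : PreservesCongruences (g a b c)
  g-cong = g-preservesCongruences a b c
  f≢0 : NonVanishing (f a b c)
  f≢0 = f-nonVanishing {a} {b} {c} {ℓ} disc nonResidue (∣ᵤ⇒∣ 8∣Δ-m)
  g≢0 : NonVanishing (g a b c)
  g≢0 = rescale-nonVanishing {a} odd (a*g≡f∘a* a b c) f≢0
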